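{- Let $D$ be a skew Young diagram whose downcore graph is not pure, and let $r$ be a row containing a box of $D$. Let $D'$ be obtained by duplicating row $r$, i.e. \[ D'=\{(x,y)\in D: y<r\}\cup\{(x,r),(x,r+1): (x,r)\in D\}\cup\{(x,y+1): (x,y)\in D,\ y>r\}. \] Then the downcore graph of $D'$ is also not pure.
   Context: Boxes are indexed by pairs $(x,y)$ of positive integers, $x$ the column (from the left) and $y$ the row (from the bottom). A Young diagram is a finite set $\lambda$ of boxes such that if $(k,\ell)\in\lambda$ then every $(k',\ell')$ with $1\le k'\le k$, $1\le \ell'\le\ell$ is in $\lambda$. A skew Young diagram is a set $D=\lambda\setminus\mu$ where $\mu\subseteq\lambda$ are Young diagrams. The downcore graph of $D$ has vertex set $D$, with an edge between $(i,j)$ and $(k,\ell)$ if and only if ($i<k$ and $j>\ell$, or $i>k$ and $j<\ell$) and both $(i,\ell)$ and $(k,j)$ belong to $D$. A graph is pure if all its maximal (with respect to inclusion) independent sets have the same size. -}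

module Defs where

open import Data.Nat using (ℕ; suc; _≤_; _<_)
open import Data.Product using (_×_; _,_; ∃-syntax)
open import Data.Sum using (_⊎_)
open import Data.List using (List; length)
open import Data.List.Membership.Propositional using (_∈_)
open import Data.List.Relation.Unary.All using (All)
open import Data.List.Relation.Unary.Unique.Propositional using (Unique)
open import Relation.Nullary using (¬_)
open import Relation.Binary.PropositionalEquality using (_≡_)

-- A box (x , y): x = column, y = row; coordinates are positive integers.
Box : Set
Box = ℕ × ℕ

-- A Young diagram: a finite set of boxes (given by a list; duplicates are
-- irrelevant, only membership matters) with positive coordinates,
-- closed downwards/leftwards.
record YoungDiagram : Set where
  field
    boxes    : List Box
    positive : ∀ {k l} → (k , l) ∈ boxes → 1 ≤ k × 1 ≤ l
    closed   : ∀ {k l k′ l′} → (k , l) ∈ boxes →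
               1 ≤ k′ → k′ ≤ k → 1 ≤ l′ → l′ ≤ l → (k′ , l′) ∈ boxes
open YoungDiagram public

_⊆ʸ_ : YoungDiagram → YoungDiagram → Set
μ ⊆ʸ la = ∀ {b} → b ∈ boxes μ → b ∈ boxes la

InSkew : YoungDiagram → YoungDiagram → Box → Set
InSkew la μ b = b ∈ boxes la × ¬ (b ∈ boxes μ)

BoxSet : Set₁
BoxSet = Box → Set

DownEdge : BoxSet → Box → Box → Set
DownEdge D (i , j) (k , l) =
  ((i < k × l < j) ⊎ (k < i × j < l)) × D (i , l) × D (k , j)

Independent : BoxSet → List Box → Set
Independent D S =
  Unique S × All D S × (∀ {a b} → a ∈ S → b ∈ S → ¬ DownEdge D a b)

MaximalIndependent : BoxSet → List Box → Set
MaximalIndependent D S =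
  Independent D S ×
  (∀ T → Independent D T → (∀ {a} → a ∈ S → a ∈ T) → ∀ {a} → a ∈ T → a ∈ S)

Pure : BoxSet → Set
Pure D = ∀ S T → MaximalIndependent D S → MaximalIndependent D T →
         length S ≡ length T

DuplicateRow : BoxSet → ℕ → BoxSet
DuplicateRow D r (x , y) =
  (y < r × D (x , y)) ⊎
  ((y ≡ r × D (x , r)) ⊎
  ((y ≡ suc r × D (x , r)) ⊎
   (∃[ y₀ ] (y ≡ suc y₀ × r < y₀ × D (x , y₀)))))

module Submission where

-- Write D′ for the diagram with row r duplicated.
-- Rows y ≤ r of D stay in place and rows y > r move up by one; this row
-- map `lift` is strictly monotone, so `shift (x , y) = (x , lift y)`
-- identifies the downcore graph of D with the subgraph of D′ induced by
-- all rows except the new copy r + 1.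
--
-- The heart of the proof (`extend`): if S is a maximal independent set
-- of D containing a box of row r, then the shift of S together with the
-- copy (xₘ , r + 1) of the rightmost box (xₘ , r) of S in row r is a
-- maximal independent set of D′ with exactly one more element.  In a skew
-- diagram every maximal independent set meets every non-empty row
-- (`maximal-meets-row`, proved by induction on columns using convexity of
-- skew diagrams), so this applies to every maximal independent set of D.
-- Two maximal independent sets of D of different sizes thus give two of
-- D′ of different sizes.

open import Defs
open import Data.Nat using (ℕ; zero; suc; _≤_; _<_; _≤?_; _≟_; _⊔_; z≤n; s≤s)
open import Data.Nat.Properties
open import Data.Nat.Induction using (<-rec)
open import Data.Product using (_×_; _,_; proj₁; proj₂; ∃-syntax)
open import Data.Product.Properties using (≡-dec)
open import Data.Sum using (_⊎_; inj₁; inj₂)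
open import Data.Empty using (⊥; ⊥-elim)
open import Data.List using (List; []; _∷_; map; length)
open import Data.List.Properties using (length-map)
open import Data.List.Relation.Unary.All as All using (_∷_)
import Data.List.Relation.Unary.All.Properties as All
open import Data.List.Relation.Unary.AllPairs using (_∷_)
open import Data.List.Relation.Unary.Any using (here; there; any?)
open import Data.List.Membership.Propositional using (_∈_; _∉_; find; lose)
open import Data.List.Membership.Propositional.Properties using (∈-map⁺; ∈-map⁻)
open import Data.List.Membership.DecPropositional (≡-dec _≟_ _≟_) using (_∈?_)
open import Data.List.Relation.Unary.Unique.Propositional using (Unique)
import Data.List.Relation.Unary.Unique.Propositional.Properties as Unique
open import Relation.Nullary using (¬_; Dec; yes; no)
open import Relation.Nullary.Decidable using (_×-dec_; ¬?)
open import Relation.Binary.PropositionalEquality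
open import Relation.Binary.Definitions using (tri<; tri≈; tri>)

greatest-witness : {P : ℕ → Set} → (∀ k → Dec (P k)) → ∀ {x} → P x →
                   ∀ n → (∀ {k} → P k → k ≤ n) →
                   ∃[ a ] P a × (∀ {k} → P k → k ≤ a)
greatest-witness P? {x} Px zero bound = x , Px , λ Pk → ≤-trans (bound Pk) z≤n
greatest-witness {P} P? Px (suc n) bound with P? (suc n)
... | yes Pn = suc n , Pn , bound
... | no ¬Pn = greatest-witness P? Px n
  (λ {k} Pk → ≤-pred (≤∧≢⇒< (bound Pk) (λ k≡n → ¬Pn (subst P k≡n Pk))))

maxColumn : List Box → ℕ
maxColumn []             = 0
maxColumn ((x , _) ∷ bs) = x ⊔ maxColumn bs

maxColumn-bound : ∀ {x y bs} → (x , y) ∈ bs → x ≤ maxColumn bs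
maxColumn-bound {bs = (x , _) ∷ bs} (here refl) = m≤m⊔n x (maxColumn bs)
maxColumn-bound {bs = (x , _) ∷ bs} (there p)   =
  ≤-trans (maxColumn-bound p) (m≤n⊔m x (maxColumn bs))

edge-sym : ∀ {D : BoxSet} {a b} → DownEdge D a b → DownEdge D b a
edge-sym (inj₁ order , Dil , Dkj) = inj₂ order , Dkj , Dil
edge-sym (inj₂ order , Dil , Dkj) = inj₁ order , Dkj , Dil

edge-irrefl : ∀ {D : BoxSet} {a} → ¬ DownEdge D a a
edge-irrefl (inj₁ (i<i , _) , _) = <-irrefl refl i<i
edge-irrefl (inj₂ (i<i , _) , _) = <-irrefl refl i<i

edge-transport : ∀ {E F : BoxSet} {i j k l j′ l′} →
                 (l < j → l′ < j′) → (j < l → j′ < l′) →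
                 (E (i , l) → F (i , l′)) → (E (k , j) → F (k , j′)) →
                 DownEdge E (i , j) (k , l) → DownEdge F (i , j′) (k , l′)
edge-transport below above corner₁ corner₂ (inj₁ (i<k , l<j) , Eil , Ekj) =
  inj₁ (i<k , below l<j) , corner₁ Eil , corner₂ Ekj
edge-transport below above corner₁ corner₂ (inj₂ (k<i , j<l) , Eil , Ekj) =
  inj₂ (k<i , above j<l) , corner₁ Eil , corner₂ Ekj

Isolated : BoxSet → List Box → Box → Set
Isolated D S c = ∀ {s} → s ∈ S → ¬ DownEdge D c s

-- A box of D outside a maximal independent set S has a neighbour in S,
-- since otherwise it could be added to S.
maximal⇒¬isolated : ∀ {D S c} → MaximalIndependent D S →
                    D c → c ∉ S → ¬ Isolated D S c
maximal⇒¬isolated {D} {S} {c} ((unique , inD , indep) , maximal) Dc c∉S isolated =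
  c∉S (maximal (c ∷ S) enlarged there (here refl))
  where
  no-edge : ∀ {a b} → a ∈ c ∷ S → b ∈ c ∷ S → ¬ DownEdge D a b
  no-edge (here refl) (here refl) = edge-irrefl {D}
  no-edge (here refl) (there b∈S) = isolated b∈S
  no-edge (there a∈S) (here refl) = λ e → isolated a∈S (edge-sym {D} e)
  no-edge (there a∈S) (there b∈S) = indep a∈S b∈S

  enlarged : Independent D (c ∷ S)
  enlarged = (All.tabulate (λ s∈S c≡s → c∉S (subst (_∈ S) (sym c≡s) s∈S)) ∷ unique)
           , (Dc ∷ inD) , no-edge

-- Conversely, an independent set from which no box of D is isolated is
-- maximal: a box of a larger independent set would be isolated from S.
¬isolated⇒maximal : ∀ {D S} → Independent D S →
                    (∀ {c} → D c → c ∉ S → ¬ Isolated D S c) →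
                    MaximalIndependent D S
¬isolated⇒maximal {D} {S} independent dominating = independent , maximal
  where
  maximal : ∀ T → Independent D T → (∀ {a} → a ∈ S → a ∈ T) → ∀ {a} → a ∈ T → a ∈ S
  maximal T (_ , inD , indep) S⊆T {c} c∈T with c ∈? S
  ... | yes c∈S = c∈S
  ... | no  c∉S = ⊥-elim (dominating (All.lookup inD c∈T) c∉S
                           (λ s∈S → indep c∈T (S⊆T s∈S)))

module SkewDiagram (la mu : YoungDiagram) where

  private
    D : BoxSet
    D = InSkew la mu

  skew? : ∀ b → Dec (D b)
  skew? b = (b ∈? boxes la) ×-dec ¬? (b ∈? boxes mu)

  convex : ∀ {a b c d j m} → D (a , c) → D (b , d) →
           a ≤ j → j ≤ b → c ≤ m → m ≤ d → D (j , m)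
  convex (ac∈λ , ac∉μ) (bd∈λ , _) a≤j j≤b c≤m m≤d =
    closed la bd∈λ (≤-trans 1≤a a≤j) j≤b (≤-trans 1≤c c≤m) m≤d ,
    λ jm∈μ → ac∉μ (closed mu jm∈μ 1≤a a≤j 1≤c c≤m)
    where
    1≤a = proj₁ (positive la ac∈λ)
    1≤c = proj₂ (positive la ac∈λ)

  column-bound : ∀ {k l} → D (k , l) → k ≤ maxColumn (boxes la)
  column-bound (kl∈λ , _) = maxColumn-bound kl∈λ

  -- The
  -- rightmost box (a , r) of D in row r would need a neighbour in S; by
  -- induction on its column, no box of S is such a neighbour.
  row-avoiding-not-maximal : ∀ {S r x} → D (x , r) → MaximalIndependent D S →
                             (∀ k → (k , r) ∉ S) → ⊥
  row-avoiding-not-maximal {S} {r} Dxr mS@((_ , inD , indep) , _) avoids =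
    maximal⇒¬isolated mS Dar (avoids a) (λ s∈S → no-neighbour _ s∈S)
    where
    rightmost = greatest-witness (λ k → skew? (k , r)) Dxr (maxColumn (boxes la)) column-bound
    a   = proj₁ rightmost
    Dar = proj₁ (proj₂ rightmost)
    a-max : ∀ {k} → D (k , r) → k ≤ a
    a-max = proj₂ (proj₂ rightmost)

    NotNeighbour : ℕ → Set
    NotNeighbour k = ∀ {l} → (k , l) ∈ S → ¬ DownEdge D (a , r) (k , l)

    -- A neighbour (k , l) of (a , r) lies north-west of it; then (k , r)
    -- needs a neighbour in S, which either is adjacent to (k , l) or is a
    -- neighbour of (a , r) in a smaller column.
    step : ∀ k → (∀ {k′} → k′ < k → NotNeighbour k′) → NotNeighbour k
    step k _ _ (inj₁ (a<k , _) , _ , Dkr) = <⇒≱ a<k (a-max Dkr)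
    step k smaller {l} kl∈S (inj₂ (k<a , r<l) , Dal , Dkr) =
      maximal⇒¬isolated mS Dkr (avoids k) kr-isolated
      where
      Dkl = All.lookup inD kl∈S
      kr-isolated : Isolated D S (k , r)
      kr-isolated {k′ , l′} s∈S (inj₁ (k<k′ , l′<r) , Dkl′ , Dk′r) =
        indep kl∈S s∈S (inj₁ (k<k′ , <-trans l′<r r<l) , Dkl′ ,
                        convex Dkl Dal (<⇒≤ k<k′) (a-max Dk′r) ≤-refl ≤-refl)
      kr-isolated {k′ , l′} s∈S (inj₂ (k′<k , r<l′) , Dkl′ , Dk′r) with ≤-<-connex l′ l
      ... | inj₂ l<l′ =
        indep s∈S kl∈S (inj₁ (k′<k , l<l′) ,
                        convex Dk′r (All.lookup inD s∈S) ≤-refl ≤-refl (<⇒≤ r<l) (<⇒≤ l<l′) , Dkl′)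
      ... | inj₁ l′≤l =
        smaller k′<k s∈S (inj₂ (<-trans k′<k k<a , r<l′) ,
                          convex Dar Dal ≤-refl ≤-refl (<⇒≤ r<l′) l′≤l , Dk′r)

    no-neighbour : ∀ k → NotNeighbour k
    no-neighbour = <-rec NotNeighbour step

  maximal-meets-row : ∀ {S r x} → D (x , r) → MaximalIndependent D S → ∃[ k ] (k , r) ∈ S
  maximal-meets-row {S} {r} Dxr mS with any? (λ s → proj₂ s ≟ r) S
  ... | yes hit = witness (find hit)
    where
    witness : (∃[ s ] s ∈ S × proj₂ s ≡ r) → ∃[ k ] (k , r) ∈ S
    witness ((k , _) , s∈S , refl) = k , s∈S
  ... | no miss = ⊥-elim (row-avoiding-not-maximal Dxr mS (λ k kr∈S → miss (lose kr∈S refl)))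

module RowDuplication (D : BoxSet) (r : ℕ) where

  D′ : BoxSet
  D′ = DuplicateRow D r

  -- The row of D′ holding row y of D.
  lift : ℕ → ℕ
  lift y with y ≤? r
  ... | yes _ = y
  ... | no  _ = suc y

  lift-cases : ∀ y → (y ≤ r × lift y ≡ y) ⊎ (r < y × lift y ≡ suc y)
  lift-cases y with y ≤? r
  ... | yes y≤r = inj₁ (y≤r , refl)
  ... | no  y≰r = inj₂ (≰⇒> y≰r , refl)

  lift-mono : ∀ {l j} → l < j → lift l < lift j
  lift-mono {l} {j} l<j with lift-cases l | lift-cases j
  ... | inj₁ (_ , eq₁)   | inj₁ (_ , eq₂)   rewrite eq₁ | eq₂ = l<j
  ... | inj₁ (_ , eq₁)   | inj₂ (_ , eq₂)   rewrite eq₁ | eq₂ = m<n⇒m<1+n l<j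
  ... | inj₂ (r<l , _)   | inj₁ (j≤r , _)   = ⊥-elim (<⇒≱ (<-trans r<l l<j) j≤r)
  ... | inj₂ (_ , eq₁)   | inj₂ (_ , eq₂)   rewrite eq₁ | eq₂ = s≤s l<j

  lift-reflects : ∀ {l j} → lift l < lift j → l < j
  lift-reflects {l} {j} lift-l<j with <-cmp l j
  ... | tri< l<j _ _  = l<j
  ... | tri≈ _ refl _ = ⊥-elim (<-irrefl refl lift-l<j)
  ... | tri> _ _ j<l  = ⊥-elim (<-asym lift-l<j (lift-mono j<l))

  lift-injective : ∀ {l j} → lift l ≡ lift j → l ≡ j
  lift-injective {l} {j} eq with <-cmp l j
  ... | tri< l<j _ _ = ⊥-elim (<-irrefl eq (lift-mono l<j))
  ... | tri≈ _ l≡j _ = l≡j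
  ... | tri> _ _ j<l = ⊥-elim (<-irrefl (sym eq) (lift-mono j<l))

  lift-fixes-r : lift r ≡ r
  lift-fixes-r with lift-cases r
  ... | inj₁ (_ , eq)   = eq
  ... | inj₂ (r<r , _)  = ⊥-elim (<-irrefl refl r<r)

  lift-skips-copy : ∀ y → lift y ≢ suc r
  lift-skips-copy y eq with lift-cases y
  ... | inj₁ (y≤r , eq′) = <⇒≱ (n<1+n r) (subst (_≤ r) (trans (sym eq′) eq) y≤r)
  ... | inj₂ (r<y , eq′) = <-irrefl (suc-injective (trans (sym eq) eq′)) r<y

  lift-below : ∀ {y} → y < r → lift y < suc r
  lift-below {y} y<r with lift-cases y
  ... | inj₁ (_ , eq)   rewrite eq = m<n⇒m<1+n y<r
  ... | inj₂ (r<y , _)  = ⊥-elim (<-asym y<r r<y)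

  lift-above : ∀ {y} → r < y → suc r < lift y
  lift-above {y} r<y with lift-cases y
  ... | inj₁ (y≤r , _)  = ⊥-elim (<⇒≱ r<y y≤r)
  ... | inj₂ (_ , eq)   rewrite eq = s≤s r<y

  below-lift : ∀ {y} → y ≢ r → lift y < suc r → y < r
  below-lift {y} y≢r lift-y<1+r with lift-cases y
  ... | inj₁ (y≤r , _)  = ≤∧≢⇒< y≤r y≢r
  ... | inj₂ (r<y , eq) rewrite eq = ⊥-elim (<-asym r<y (≤-pred lift-y<1+r))

  above-lift : ∀ {y} → suc r < lift y → r < y
  above-lift {y} 1+r<lift-y with lift-cases y
  ... | inj₁ (y≤r , eq) rewrite eq = ⊥-elim (<⇒≱ 1+r<lift-y (m≤n⇒m≤1+n y≤r))
  ... | inj₂ (r<y , _)  = r<y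

  shift : Box → Box
  shift (x , y) = x , lift y

  shift-injective : ∀ {p q} → shift p ≡ shift q → p ≡ q
  shift-injective eq = cong₂ _,_ (cong proj₁ eq) (lift-injective (cong proj₂ eq))

  shift-into : ∀ {x y} → D (x , y) → D′ (x , lift y)
  shift-into {x} {y} Dxy with <-cmp y r | lift-cases y
  ... | tri< y<r _ _  | inj₁ (_ , eq)   rewrite eq = inj₁ (y<r , Dxy)
  ... | tri≈ _ refl _ | inj₁ (_ , eq)   rewrite eq = inj₂ (inj₁ (refl , Dxy))
  ... | tri> _ _ r<y  | inj₂ (_ , eq)   rewrite eq = inj₂ (inj₂ (inj₂ (y , refl , r<y , Dxy)))
  ... | tri< y<r _ _  | inj₂ (r<y , _)  = ⊥-elim (<-asym y<r r<y)
  ... | tri≈ _ refl _ | inj₂ (r<r , _)  = ⊥-elim (<-irrefl refl r<r)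
  ... | tri> _ _ r<y  | inj₁ (y≤r , _)  = ⊥-elim (<⇒≱ r<y y≤r)

  copy-into : ∀ {x} → D (x , r) → D′ (x , suc r)
  copy-into Dxr = inj₂ (inj₂ (inj₁ (refl , Dxr)))

  D′-cases : ∀ {x y} → D′ (x , y) →
             (∃[ y₀ ] y ≡ lift y₀ × D (x , y₀)) ⊎ (y ≡ suc r × D (x , r))
  D′-cases {y = y} (inj₁ (y<r , Dxy)) with lift-cases y
  ... | inj₁ (_ , eq)  = inj₁ (y , sym eq , Dxy)
  ... | inj₂ (r<y , _) = ⊥-elim (<-asym y<r r<y)
  D′-cases (inj₂ (inj₁ (refl , Dxr)))         = inj₁ (r , sym lift-fixes-r , Dxr)
  D′-cases (inj₂ (inj₂ (inj₁ (refl , Dxr))))  = inj₂ (refl , Dxr)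
  D′-cases (inj₂ (inj₂ (inj₂ (y₀ , refl , r<y₀ , Dxy₀)))) with lift-cases y₀
  ... | inj₁ (y₀≤r , _) = ⊥-elim (<⇒≱ r<y₀ y₀≤r)
  ... | inj₂ (_ , eq)   = inj₁ (y₀ , sym eq , Dxy₀)

  shift-from : ∀ {x y} → D′ (x , lift y) → D (x , y)
  shift-from {x} {y} D′xy with D′-cases D′xy
  ... | inj₁ (y₀ , eq , Dxy₀) = subst (λ z → D (x , z)) (sym (lift-injective eq)) Dxy₀
  ... | inj₂ (eq , _)         = ⊥-elim (lift-skips-copy y eq)

  copy-from : ∀ {x} → D′ (x , suc r) → D (x , r)
  copy-from D′xr with D′-cases D′xr
  ... | inj₁ (y₀ , eq , _) = ⊥-elim (lift-skips-copy y₀ (sym eq))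
  ... | inj₂ (_ , Dxr)     = Dxr

  shift-edge : ∀ {p q} → DownEdge D p q → DownEdge D′ (shift p) (shift q)
  shift-edge {_ , _} {_ , _} = edge-transport {D} {D′} lift-mono lift-mono shift-into shift-into

  shift-edge⁻ : ∀ {p q} → DownEdge D′ (shift p) (shift q) → DownEdge D p q
  shift-edge⁻ {_ , _} {_ , _} = edge-transport {D′} {D} lift-reflects lift-reflects shift-from shift-from

  copy-edge : ∀ {x k l} → DownEdge D (x , r) (k , l) → DownEdge D′ (x , suc r) (k , lift l)
  copy-edge = edge-transport {D} {D′} lift-below lift-above shift-into copy-into

  copy-edge⁻ : ∀ {x k l} → l ≢ r →
               DownEdge D′ (x , suc r) (k , lift l) → DownEdge D (x , r) (k , l)
  copy-edge⁻ l≢r = edge-transport {D′} {D} (below-lift l≢r) above-lift shift-from copy-from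

  extend : ∀ {S x} → MaximalIndependent D S → (x , r) ∈ S →
           ∃[ S′ ] MaximalIndependent D′ S′ × length S′ ≡ suc (length S)
  extend {S} mS@((unique , inD , indep) , _) xr∈S =
    S⁺ , ¬isolated⇒maximal (S⁺-unique , S⁺-inD′ , S⁺-no-edge) dominating ,
    cong suc (length-map shift S)
    where
    rightmost = greatest-witness (λ k → (k , r) ∈? S) xr∈S (maxColumn S) maxColumn-bound
    xₘ    = proj₁ rightmost
    xₘr∈S = proj₁ (proj₂ rightmost)
    xₘ-max : ∀ {k} → (k , r) ∈ S → k ≤ xₘ
    xₘ-max = proj₂ (proj₂ rightmost)

    S⁺ : List Box
    S⁺ = (xₘ , suc r) ∷ map shift S

    -- A neighbour of the copy in row r would lie right of (xₘ , r); one in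
    -- another row comes from an edge of D at (xₘ , r) inside S.
    copy-isolated : Isolated D′ (map shift S) (xₘ , suc r)
    copy-isolated s∈ e with ∈-map⁻ shift s∈
    copy-isolated _ e | (k , l) , s∈S , refl with l ≟ r
    ... | no l≢r = indep xₘr∈S s∈S (copy-edge⁻ l≢r e)
    copy-isolated _ (inj₁ (xₘ<k , _) , _) | (k , _) , s∈S , refl | yes refl =
      <⇒≱ xₘ<k (xₘ-max s∈S)
    copy-isolated _ (inj₂ (_ , 1+r<lift-r) , _) | (k , _) , s∈S , refl | yes refl =
      <-asym 1+r<lift-r (subst (_< suc r) (sym lift-fixes-r) (n<1+n r))

    S⁺-unique : Unique S⁺
    S⁺-unique = All.tabulate copy-not-shifted ∷ Unique.map⁺ shift-injective unique
      where
      copy-not-shifted : ∀ {b} → b ∈ map shift S → (xₘ , suc r) ≢ b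
      copy-not-shifted b∈ eq with ∈-map⁻ shift b∈
      ... | (_ , y) , _ , refl = lift-skips-copy y (sym (cong proj₂ eq))

    S⁺-inD′ : All.All D′ S⁺
    S⁺-inD′ = copy-into (All.lookup inD xₘr∈S) ∷ All.map⁺ (All.map shift-into inD)

    S⁺-no-edge : ∀ {a b} → a ∈ S⁺ → b ∈ S⁺ → ¬ DownEdge D′ a b
    S⁺-no-edge (here refl) (here refl) = edge-irrefl {D′}
    S⁺-no-edge (here refl) (there b∈)  = copy-isolated b∈
    S⁺-no-edge (there a∈)  (here refl) = λ e → copy-isolated a∈ (edge-sym {D′} e)
    S⁺-no-edge (there a∈)  (there b∈)  with ∈-map⁻ shift a∈ | ∈-map⁻ shift b∈
    ... | _ , p∈S , refl | _ , q∈S , refl = λ e → indep p∈S q∈S (shift-edge⁻ e)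

    -- Every box of D′ outside S⁺ has a neighbour in S⁺: a shifted box
    -- inherits one from S, and a copy (x , r + 1) of a box of row r is
    -- adjacent to the shift of a neighbour of (x , r), or, if (x , r) ∈ S,
    -- to the shift of (xₘ , r).
    dominating : ∀ {c} → D′ c → c ∉ S⁺ → ¬ Isolated D′ S⁺ c
    dominating {x , y} D′c c∉S⁺ isolated with D′-cases D′c
    ... | inj₁ (y₀ , refl , Dxy₀) =
      maximal⇒¬isolated mS Dxy₀ (λ p∈S → c∉S⁺ (there (∈-map⁺ shift p∈S)))
        (λ s∈S e → isolated (there (∈-map⁺ shift s∈S)) (shift-edge e))
    ... | inj₂ (refl , Dxr) with (x , r) ∈? S
    ...   | no xr∉S =
      maximal⇒¬isolated mS Dxr xr∉S
        (λ {(_ , _)} s∈S e → isolated (there (∈-map⁺ shift s∈S)) (copy-edge e))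
    ...   | yes xr∈S with x ≟ xₘ
    ...     | yes refl = c∉S⁺ (here refl)
    ...     | no x≢xₘ  =
      isolated (there (∈-map⁺ shift xₘr∈S))
        (inj₁ (≤∧≢⇒< (xₘ-max xr∈S) x≢xₘ , subst (_< suc r) (sym lift-fixes-r) (n<1+n r)) ,
         shift-into Dxr , copy-into (All.lookup inD xₘr∈S))

lemma3p10 : (λ′ μ : YoungDiagram) → μ ⊆ʸ λ′ →
    ¬ Pure (InSkew λ′ μ) →
    (r : ℕ) → ∃[ x ] InSkew λ′ μ (x , r) →
    ¬ Pure (DuplicateRow (InSkew λ′ μ) r)
lemma3p10 la mu _ impure r (x , Dxr) pure′ = impure sizes-agree
  where
  open SkewDiagram la mu
  open RowDuplication (InSkew la mu) r

  extend′ : ∀ {S} → MaximalIndependent (InSkew la mu) S →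
            ∃[ S′ ] MaximalIndependent D′ S′ × length S′ ≡ suc (length S)
  extend′ mS = extend mS (proj₂ (maximal-meets-row Dxr mS))

  sizes-agree : Pure (InSkew la mu)
  sizes-agree S T mS mT with extend′ mS | extend′ mT
  ... | S′ , mS′ , |S′| | T′ , mT′ , |T′| = suc-injective (begin
    suc (length S) ≡⟨ sym |S′| ⟩
    length S′      ≡⟨ pure′ S′ T′ mS′ mT′ ⟩
    length T′      ≡⟨ |T′| ⟩
    suc (length T) ∎)
    where open ≡-Reasoning
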